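{- Let $\mathcal B=\{B_1,\dots,B_n\}$ be a collection of finite sets and let $\mathcal B'=\{B'_1,\dots,B'_n\}$ be obtained from $\mathcal B$ by adding an even number of new elements (not in $B_1\cup\dots\cup B_n$) to each Venn region, i.e. $B_i\subseteq B'_i$, $B'_i\cap(B_1\cup\dots\cup B_n)=B_i$, and for every nonempty $I\subseteq\{1,\dots,n\}$ the number of new elements $x\in(\bigcup_i B'_i)\setminus(\bigcup_i B_i)$ with $\{i: x\in B'_i\}=I$ is even. If $\mathcal B$ is $\frac12$-splittable, then so is $\mathcal B'$.
   Context: A collection $\{B_1,\dots,B_n\}$ of finite sets is $\frac12$-splittable if there is a set $S$ such that for every $i$, $|S\cap B_i|\in\{\lfloor |B_i|/2\rfloor,\lceil |B_i|/2\rceil\}$. -}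

module Defs where

open import Data.Nat using (ℕ; ⌊_/2⌋; ⌈_/2⌉)
open import Data.Nat.Divisibility using (_∣_)
open import Data.Bool using (Bool; true; false)
import Data.Bool.Properties as BoolP
open import Data.Fin using (Fin)
open import Data.Fin.Subset using (Subset; _∈_; _∉_; _⊆_; _∩_; ⋃; ∣_∣; Nonempty; inside; outside)
open import Data.Fin.Subset.Properties using (_∈?_)
import Data.List as List
open import Data.Vec using (tabulate; lookup)
open import Data.Vec.Properties using (≡-dec)
open import Data.Product using (∃)
open import Data.Sum using (_⊎_)
open import Relation.Binary.PropositionalEquality using (_≡_)
open import Relation.Nullary using (Dec; yes; no; ¬_)
open import Relation.Nullary.Decidable using (⌊_⌋; _×-dec_; ¬?)

-- All sets live in a common finite ground set Fin N.
-- A collection {B_1,...,B_n} is a family  B : Fin n → Subset N.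

Union : ∀ {n N} → (Fin n → Subset N) → Subset N
Union {n} B = ⋃ (List.tabulate B)

HalfSplits : ∀ {N} → Subset N → Subset N → Set
HalfSplits S A = (∣ S ∩ A ∣ ≡ ⌊ ∣ A ∣ /2⌋) ⊎ (∣ S ∩ A ∣ ≡ ⌈ ∣ A ∣ /2⌉)

HalfSplittable : ∀ {n N} → (Fin n → Subset N) → Set
HalfSplittable {n} {N} B = ∃ λ (S : Subset N) → ∀ (i : Fin n) → HalfSplits S (B i)

pattern-of : ∀ {n N} → (Fin n → Subset N) → Fin N → Subset n
pattern-of B' x = tabulate λ i → lookup (B' i) x

NewRegion : ∀ {n N} → (Fin n → Subset N) → (Fin n → Subset N) → Subset n → Subset N
NewRegion B B' I =
  tabulate λ x → ⌊ ¬? (x ∈? Union B) ×-dec ≡-dec BoolP._≟_ (pattern-of B' x) I ⌋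

EvenExtension : ∀ {n N} → (Fin n → Subset N) → (Fin n → Subset N) → Set
EvenExtension {n} B B' =
  (∀ i → B i ⊆ B' i)
  × (∀ i → B' i ∩ Union B ≡ B i)
  × (∀ (I : Subset n) → Nonempty I → 2 ∣ ∣ NewRegion B B' I ∣)
  where open Data.Product using (_×_)

-- Group the new elements by their pattern {i : x ∈ B'ᵢ}.  Every nonempty pattern
-- class has even size, so its elements can be paired off.  Extend S by one element
-- of each pair: this adds exactly half of the new elements of each B'ᵢ, and adding
-- k to |S ∩ Bᵢ| and 2k to |Bᵢ| preserves the half-split.
module Submission where

open import Defs
open import Data.Bool using (Bool; true; false; not; _∧_; if_then_else_)
import Data.Bool.Properties as Bool
open import Data.Fin using (Fin; zero; suc; _≟_)
import Data.Fin.Properties as Fin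
open import Data.Fin.Subset using (Subset; _∈_; _∩_; ∣_∣; Nonempty; ⊥)
open import Data.Fin.Subset.Properties using (_∈?_; ∉⊥; nonempty?; Empty-unique)
open import Data.Nat using (ℕ; zero; suc; _+_; _*_; ⌊_/2⌋; ⌈_/2⌉)
open import Data.Nat.Divisibility using (_∣_; ∣m+n∣m⇒∣n; m∣m*n; ∣1⇒≡1)
open import Data.Nat.Properties using (*-suc; +-suc; +-identityʳ; *-distribˡ-+; +-commutativeSemigroup)
open import Algebra.Properties.CommutativeSemigroup +-commutativeSemigroup using (x∙yz≈y∙xz)
open import Data.Product using (∃; _,_)
import Data.Sum
open import Data.Vec using (_∷_; tabulate; lookup)
open import Data.Vec.Properties
  using (≡-dec; tabulate-cong; tabulate∘lookup; lookup∘tabulate; lookup-zipWith; lookup-replicate)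
import Data.Vec.Functional as Vector
open import Data.Vec.Functional.Properties using (updateAt-updates; updateAt-minimal; map-updateAt-local)
open import Function using (_∘_; const)
open import Relation.Binary.PropositionalEquality
open import Relation.Nullary using (Dec; yes; no; does; contradiction)
open import Relation.Nullary.Decidable using (⌊_⌋; isYes≗does; dec-true; dec-false; ¬?; _×-dec_)

open Vector using (updateAt)

⟦_⟧ : Bool → ℕ
⟦ true ⟧  = 1
⟦ false ⟧ = 0

count : ∀ {N} → (Fin N → Bool) → ℕ
count f = ∣ tabulate f ∣

count-cong : ∀ {N} {f g : Fin N → Bool} → (∀ x → f x ≡ g x) → count f ≡ count g
count-cong = cong ∣_∣ ∘ tabulate-cong

count-lookup : ∀ {N} (p : Subset N) → count (lookup p) ≡ ∣ p ∣
count-lookup p = cong ∣_∣ (tabulate∘lookup p)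

count-∩ : ∀ {N} (p r : Subset N) → count (λ x → lookup p x ∧ lookup r x) ≡ ∣ p ∩ r ∣
count-∩ p r = trans (count-cong λ x → sym (lookup-zipWith _∧_ x p r)) (count-lookup (p ∩ r))

count-suc : ∀ {N} (f : Fin (suc N) → Bool) → count f ≡ ⟦ f zero ⟧ + count (f ∘ suc)
count-suc f with f zero
... | true  = refl
... | false = refl

count-false : ∀ {N} {f : Fin N → Bool} → (∀ x → f x ≡ false) → count f ≡ 0
count-false {zero}  f≡false = refl
count-false {suc N} {f} f≡false rewrite f≡false zero = count-false (f≡false ∘ suc)

count-partition : ∀ {N} (c f : Fin N → Bool) →
  count f ≡ count (λ x → c x ∧ f x) + count (λ x → not (c x) ∧ f x)
count-partition {zero}  c f = refl
count-partition {suc N} c f with c zero | f zero | count-partition (c ∘ suc) (f ∘ suc)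
... | true  | true  | eq = cong suc eq
... | true  | false | eq = eq
... | false | true  | eq = trans (cong suc eq) (sym (+-suc _ _))
... | false | false | eq = eq

count-updateAt : ∀ {N} (f : Fin N → Bool) (y : Fin N) →
  count f ≡ ⟦ f y ⟧ + count (updateAt f y (const false))
count-updateAt f zero    = count-suc f
count-updateAt f (suc y) = begin
  count f                                                       ≡⟨ count-suc f ⟩
  ⟦ f zero ⟧ + count (f ∘ suc)                                  ≡⟨ cong (⟦ f zero ⟧ +_) (count-updateAt (f ∘ suc) y) ⟩
  ⟦ f zero ⟧ + (⟦ f (suc y) ⟧ + rest)                           ≡⟨ x∙yz≈y∙xz ⟦ f zero ⟧ ⟦ f (suc y) ⟧ rest ⟩
  ⟦ f (suc y) ⟧ + (⟦ f zero ⟧ + rest)                           ≡⟨ cong (⟦ f (suc y) ⟧ +_) (sym (count-suc f′)) ⟩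
  ⟦ f (suc y) ⟧ + count f′                                      ∎
  where
  open ≡-Reasoning
  f′ = updateAt f (suc y) (const false)
  rest = count (f′ ∘ suc)

count-erase : ∀ {ℓ N} {A : Set ℓ} (g : A → Bool) (xs : Fin N → A) (y : Fin N) {a : A} →
  g a ≡ false → count (g ∘ xs) ≡ ⟦ g (xs y) ⟧ + count (g ∘ updateAt xs y (const a))
count-erase g xs y ga≡false = trans (count-updateAt (g ∘ xs) y)
  (cong (⟦ g (xs y) ⟧ +_) (count-cong λ x → sym (map-updateAt-local {f = g} xs y ga≡false x)))

count-paired : ∀ {ℓ N} {A : Set ℓ} (g : A → Bool) (xs : Fin (suc N) → A) (y : Fin N) {a : A} →
  g a ≡ false → xs (suc y) ≡ xs zero →
  count (g ∘ xs) ≡ 2 * ⟦ g (xs zero) ⟧ + count (g ∘ updateAt (xs ∘ suc) y (const a))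
count-paired g xs y ga≡false xsy≡xs₀ = begin
  count (g ∘ xs)                            ≡⟨ count-suc (g ∘ xs) ⟩
  ⟦ c ⟧ + count (g ∘ xs ∘ suc)              ≡⟨ cong (⟦ c ⟧ +_) (count-erase g (xs ∘ suc) y ga≡false) ⟩
  ⟦ c ⟧ + (⟦ g (xs (suc y)) ⟧ + rest)       ≡⟨ cong (λ z → ⟦ c ⟧ + (⟦ g z ⟧ + rest)) xsy≡xs₀ ⟩
  ⟦ c ⟧ + (⟦ c ⟧ + rest)                    ≡⟨ ⟦b⟧+⟦b⟧+n c rest ⟩
  2 * ⟦ c ⟧ + rest                          ∎
  where
  open ≡-Reasoning
  c = g (xs zero)
  rest = count (g ∘ updateAt (xs ∘ suc) y (const _))
  ⟦b⟧+⟦b⟧+n : ∀ b n → ⟦ b ⟧ + (⟦ b ⟧ + n) ≡ 2 * ⟦ b ⟧ + n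
  ⟦b⟧+⟦b⟧+n true  n = refl
  ⟦b⟧+⟦b⟧+n false n = refl

_≟ₛ_ : ∀ {n} (p r : Subset n) → Dec (p ≡ r)
_≟ₛ_ = ≡-dec Bool._≟_

⊥≢nonempty : ∀ {n} {I : Subset n} → Nonempty I → ⊥ ≢ I
⊥≢nonempty (i , i∈I) ⊥≡I = ∉⊥ (subst (i ∈_) (sym ⊥≡I) i∈I)

⊥≟ₛnonempty : ∀ {n} {I : Subset n} → Nonempty I → does (⊥ ≟ₛ I) ≡ false
⊥≟ₛnonempty ne = dec-false (⊥ ≟ₛ _) (⊥≢nonempty ne)

EvenClasses : ∀ {n N} → (Fin N → Subset n) → Set
EvenClasses {n} q = ∀ (I : Subset n) → Nonempty I → 2 ∣ count (λ x → does (q x ≟ₛ I))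

Halvable : ∀ {n N} → (Fin N → Subset n) → Set
Halvable {n} {N} q = ∃ λ (T : Fin N → Bool) → ∀ (i : Fin n) →
  count (λ x → lookup (q x) i) ≡ 2 * count (λ x → T x ∧ lookup (q x) i)

partner : ∀ {n N} (q : Fin (suc N) → Subset n) → EvenClasses q → Nonempty (q zero) →
  ∃ λ y → q (suc y) ≡ q zero
partner q even ne with Fin.any? (λ y → q (suc y) ≟ₛ q zero)
... | yes found = found
... | no  none  = contradiction (∣1⇒≡1 (subst (2 ∣_) class-of-q₀ (even (q zero) ne))) λ ()
  where
  class-of-q₀ : count (λ x → does (q x ≟ₛ q zero)) ≡ 1
  class-of-q₀ = trans (count-suc (λ x → does (q x ≟ₛ q zero)))
    (cong₂ _+_ (cong ⟦_⟧ (dec-true (q zero ≟ₛ q zero) refl))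
               (count-false λ y → dec-false (q (suc y) ≟ₛ q zero) λ eq → none (y , eq)))

evenClasses-skip : ∀ {n N} (q : Fin (suc N) → Subset n) → q zero ≡ ⊥ →
  EvenClasses q → EvenClasses (q ∘ suc)
evenClasses-skip q q₀≡⊥ even I ne = subst (2 ∣_) class-count (even I ne)
  where
  class-count : count (λ x → does (q x ≟ₛ I)) ≡ count (λ x → does (q (suc x) ≟ₛ I))
  class-count = trans (count-suc (λ x → does (q x ≟ₛ I)))
    (cong (λ b → ⟦ b ⟧ + count (λ x → does (q (suc x) ≟ₛ I)))
          (trans (cong (λ p → does (p ≟ₛ I)) q₀≡⊥) (⊥≟ₛnonempty ne)))

evenClasses-pair : ∀ {n N} (q : Fin (suc N) → Subset n) (y : Fin N) → q (suc y) ≡ q zero →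
  EvenClasses q → EvenClasses (updateAt (q ∘ suc) y (const ⊥))
evenClasses-pair q y qy≡q₀ even I ne = ∣m+n∣m⇒∣n
  (subst (2 ∣_) (count-paired (λ p → does (p ≟ₛ I)) q y (⊥≟ₛnonempty ne) qy≡q₀) (even I ne))
  (m∣m*n ⟦ does (q zero ≟ₛ I) ⟧)

halvable-skip : ∀ {n N} (q : Fin (suc N) → Subset n) → q zero ≡ ⊥ →
  Halvable (q ∘ suc) → Halvable q
halvable-skip q q₀≡⊥ (T , halves) = false Vector.∷ T , λ i → begin
  count (λ x → lookup (q x) i)              ≡⟨ count-suc (λ x → lookup (q x) i) ⟩
  ⟦ lookup (q zero) i ⟧ + count (column i)  ≡⟨ cong (λ p → ⟦ lookup p i ⟧ + count (column i)) q₀≡⊥ ⟩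
  ⟦ lookup ⊥ i ⟧ + count (column i)         ≡⟨ cong (λ b → ⟦ b ⟧ + count (column i)) (lookup-replicate i false) ⟩
  count (column i)                          ≡⟨ halves i ⟩
  2 * count (λ x → T x ∧ column i x)        ∎
  where
  open ≡-Reasoning
  column = λ i x → lookup (q (suc x)) i

unmark-∧-lookup : ∀ {n N} (T : Fin N → Bool) (xs : Fin N → Subset n) (y x : Fin N) (i : Fin n) →
  T x ∧ lookup (updateAt xs y (const ⊥) x) i ≡ updateAt T y (const false) x ∧ lookup (xs x) i
unmark-∧-lookup T xs y x i with x ≟ y
... | yes refl rewrite updateAt-updates x {const ⊥} xs | updateAt-updates x {const false} T =
  trans (cong (T x ∧_) (lookup-replicate i false)) (Bool.∧-zeroʳ (T x))
... | no x≢y rewrite updateAt-minimal x y {const ⊥} xs x≢y | updateAt-minimal x y {const false} T x≢y =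
  refl

halvable-pair : ∀ {n N} (q : Fin (suc N) → Subset n) (y : Fin N) → q (suc y) ≡ q zero →
  Halvable (updateAt (q ∘ suc) y (const ⊥)) → Halvable q
halvable-pair q y qy≡q₀ (T , halves) = true Vector.∷ T′ , λ i → begin
  count (λ x → lookup (q x) i)
    ≡⟨ count-paired (λ p → lookup p i) q y (lookup-replicate i false) qy≡q₀ ⟩
  2 * ⟦ lookup (q zero) i ⟧ + count (λ x → lookup (q′ x) i)
    ≡⟨ cong (2 * ⟦ lookup (q zero) i ⟧ +_) (halves i) ⟩
  2 * ⟦ lookup (q zero) i ⟧ + 2 * count (λ x → T x ∧ lookup (q′ x) i)
    ≡⟨ sym (*-distribˡ-+ 2 ⟦ lookup (q zero) i ⟧ _) ⟩
  2 * (⟦ lookup (q zero) i ⟧ + count (λ x → T x ∧ lookup (q′ x) i))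
    ≡⟨ cong (λ k → 2 * (⟦ lookup (q zero) i ⟧ + k))
            (count-cong λ x → unmark-∧-lookup T (q ∘ suc) y x i) ⟩
  2 * (⟦ lookup (q zero) i ⟧ + count (λ x → T′ x ∧ lookup (q (suc x)) i))
    ≡⟨ cong (2 *_) (sym (count-suc (λ x → (true Vector.∷ T′) x ∧ lookup (q x) i))) ⟩
  2 * count (λ x → (true Vector.∷ T′) x ∧ lookup (q x) i) ∎
  where
  open ≡-Reasoning
  q′ = updateAt (q ∘ suc) y (const ⊥)
  T′ = updateAt T y (const false)

-- Mark element 0 and erase the pattern of an element of the same class, leaving
-- a smaller instance with even classes.
evenClasses⇒halvable : ∀ {n N} (q : Fin N → Subset n) → EvenClasses q → Halvable q
evenClasses⇒halvable {N = zero}  q even = (λ ()) , λ i → refl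
evenClasses⇒halvable {N = suc N} q even with nonempty? (q zero)
... | no empty = halvable-skip q q₀≡⊥ (evenClasses⇒halvable (q ∘ suc) (evenClasses-skip q q₀≡⊥ even))
  where q₀≡⊥ = Empty-unique empty
... | yes ne with partner q even ne
...   | y , qy≡q₀ = halvable-pair q y qy≡q₀ (evenClasses⇒halvable (updateAt (q ∘ suc) y (const ⊥))
                                                                 (evenClasses-pair q y qy≡q₀ even))

halving-shift : (h : ℕ → ℕ) → (∀ m → h (2 + m) ≡ suc (h m)) → ∀ m k → h (m + 2 * k) ≡ h m + k
halving-shift h step m zero    = trans (cong h (+-identityʳ m)) (sym (+-identityʳ (h m)))
halving-shift h step m (suc k) = begin
  h (m + 2 * suc k)     ≡⟨ cong (λ j → h (m + j)) (*-suc 2 k) ⟩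
  h (m + (2 + 2 * k))   ≡⟨ cong h (x∙yz≈y∙xz m 2 (2 * k)) ⟩
  h (2 + (m + 2 * k))   ≡⟨ step (m + 2 * k) ⟩
  suc (h (m + 2 * k))   ≡⟨ cong suc (halving-shift h step m k) ⟩
  suc (h m + k)         ≡⟨ sym (+-suc (h m) k) ⟩
  h m + suc k           ∎
  where open ≡-Reasoning

halfSplits-extend : ∀ {N} {S A S′ A′ : Subset N} (k : ℕ) →
  ∣ A′ ∣ ≡ ∣ A ∣ + 2 * k → ∣ S′ ∩ A′ ∣ ≡ ∣ S ∩ A ∣ + k → HalfSplits S A → HalfSplits S′ A′
halfSplits-extend {S = S} {A} {S′} {A′} k ∣A′∣≡ ∣S′∩A′∣≡ =
  Data.Sum.map (shift {⌊_/2⌋} λ _ → refl) (shift {⌈_/2⌉} λ _ → refl)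
  where
  shift : {h : ℕ → ℕ} → (∀ m → h (2 + m) ≡ suc (h m)) → ∣ S ∩ A ∣ ≡ h ∣ A ∣ → ∣ S′ ∩ A′ ∣ ≡ h ∣ A′ ∣
  shift {h} step split = begin
    ∣ S′ ∩ A′ ∣       ≡⟨ ∣S′∩A′∣≡ ⟩
    ∣ S ∩ A ∣ + k     ≡⟨ cong (_+ k) split ⟩
    h ∣ A ∣ + k       ≡⟨ sym (halving-shift h step ∣ A ∣ k) ⟩
    h (∣ A ∣ + 2 * k) ≡⟨ cong h (sym ∣A′∣≡) ⟩
    h ∣ A′ ∣          ∎
    where open ≡-Reasoning

does-∈? : ∀ {N} (x : Fin N) (p : Subset N) → does (x ∈? p) ≡ lookup p x
does-∈? zero    (true  ∷ p) = refl
does-∈? zero    (false ∷ p) = refl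
does-∈? (suc x) (_     ∷ p) = does-∈? x p

module _ {n N : ℕ} (B B′ : Fin n → Subset N) where

  -- Old elements get the empty pattern, which lies in no column and in no class
  -- that EvenClasses constrains.
  newPattern : Fin N → Subset n
  newPattern x = if does (x ∈? Union B) then ⊥ else pattern-of B′ x

  glue : Subset N → (Fin N → Bool) → Subset N
  glue S T = tabulate λ x → if does (x ∈? Union B) then lookup S x else T x

  evenExtension⇒evenClasses : EvenExtension B B′ → EvenClasses newPattern
  evenExtension⇒evenClasses (_ , _ , even) I ne = subst (2 ∣_) (count-cong region) (even I ne)
    where
    region : ∀ x → ⌊ ¬? (x ∈? Union B) ×-dec (pattern-of B′ x ≟ₛ I) ⌋ ≡ does (newPattern x ≟ₛ I)
    region x with x ∈? Union B
    ... | yes _ = sym (⊥≟ₛnonempty ne)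
    ... | no  _ = isYes≗does _

  module _ (restrict : ∀ i → B′ i ∩ Union B ≡ B i) (i : Fin n) where

    count-glued : (s t : Fin N → Bool) →
      count (λ x → (if does (x ∈? Union B) then s x else t x) ∧ lookup (B′ i) x)
        ≡ count (λ x → s x ∧ lookup (B i) x) + count (λ x → t x ∧ lookup (newPattern x) i)
    count-glued s t = trans (count-partition (λ x → does (x ∈? Union B)) _)
                            (cong₂ _+_ (count-cong old) (count-cong new))
      where
      ∈?∧B′≡B : ∀ x → does (x ∈? Union B) ∧ lookup (B′ i) x ≡ lookup (B i) x
      ∈?∧B′≡B x = begin
        does (x ∈? Union B) ∧ lookup (B′ i) x ≡⟨ cong (_∧ lookup (B′ i) x) (does-∈? x (Union B)) ⟩
        lookup (Union B) x ∧ lookup (B′ i) x  ≡⟨ Bool.∧-comm (lookup (Union B) x) _ ⟩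
        lookup (B′ i) x ∧ lookup (Union B) x  ≡⟨ sym (lookup-zipWith _∧_ x (B′ i) (Union B)) ⟩
        lookup (B′ i ∩ Union B) x             ≡⟨ cong (λ p → lookup p x) (restrict i) ⟩
        lookup (B i) x                        ∎
        where open ≡-Reasoning
      old : ∀ x → does (x ∈? Union B) ∧ ((if does (x ∈? Union B) then s x else t x) ∧ lookup (B′ i) x)
                    ≡ s x ∧ lookup (B i) x
      old x with x ∈? Union B | ∈?∧B′≡B x
      ... | yes _ | b′≡b    = cong (s x ∧_) b′≡b
      ... | no  _ | false≡b = sym (trans (cong (s x ∧_) (sym false≡b)) (Bool.∧-zeroʳ (s x)))
      new : ∀ x → not (does (x ∈? Union B)) ∧ ((if does (x ∈? Union B) then s x else t x) ∧ lookup (B′ i) x)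
                    ≡ t x ∧ lookup (newPattern x) i
      new x with x ∈? Union B
      ... | yes _ = sym (trans (cong (t x ∧_) (lookup-replicate i false)) (Bool.∧-zeroʳ (t x)))
      ... | no  _ = cong (t x ∧_) (sym (lookup∘tabulate (λ j → lookup (B′ j) x) i))

    ∣B′∣≡∣B∣+new : ∣ B′ i ∣ ≡ ∣ B i ∣ + count (λ x → lookup (newPattern x) i)
    ∣B′∣≡∣B∣+new = begin
      ∣ B′ i ∣                 ≡⟨ sym (count-lookup (B′ i)) ⟩
      count (lookup (B′ i))    ≡⟨ count-cong (λ x → cong (_∧ lookup (B′ i) x) (if-same (does (x ∈? Union B)))) ⟩
      count (λ x → (if does (x ∈? Union B) then true else true) ∧ lookup (B′ i) x)
        ≡⟨ count-glued (const true) (const true) ⟩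
      count (lookup (B i)) + count (λ x → lookup (newPattern x) i)
        ≡⟨ cong (_+ count (λ x → lookup (newPattern x) i)) (count-lookup (B i)) ⟩
      ∣ B i ∣ + count (λ x → lookup (newPattern x) i) ∎
      where
      open ≡-Reasoning
      if-same : ∀ b → true ≡ (if b then true else true)
      if-same true  = refl
      if-same false = refl

    ∣glue∩B′∣≡∣S∩B∣+marked : ∀ S T →
      ∣ glue S T ∩ B′ i ∣ ≡ ∣ S ∩ B i ∣ + count (λ x → T x ∧ lookup (newPattern x) i)
    ∣glue∩B′∣≡∣S∩B∣+marked S T = begin
      ∣ glue S T ∩ B′ i ∣                           ≡⟨ sym (count-∩ (glue S T) (B′ i)) ⟩
      count (λ x → lookup (glue S T) x ∧ lookup (B′ i) x)
        ≡⟨ count-cong (λ x → cong (_∧ lookup (B′ i) x) (lookup∘tabulate _ x)) ⟩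
      count (λ x → (if does (x ∈? Union B) then lookup S x else T x) ∧ lookup (B′ i) x)
        ≡⟨ count-glued (lookup S) T ⟩
      count (λ x → lookup S x ∧ lookup (B i) x) + marked
        ≡⟨ cong (_+ marked) (count-∩ S (B i)) ⟩
      ∣ S ∩ B i ∣ + marked                          ∎
      where
      open ≡-Reasoning
      marked = count (λ x → T x ∧ lookup (newPattern x) i)

lemma4p1 : ∀ {n N : ℕ} (B B' : Fin n → Subset N) →
    EvenExtension B B' → HalfSplittable B → HalfSplittable B'
lemma4p1 B B′ ext@(_ , restrict , _) (S , S-splits)
  with evenClasses⇒halvable (newPattern B B′) (evenExtension⇒evenClasses B B′ ext)
... | T , halves = glue B B′ S T , λ i →
  halfSplits-extend {S = S} {B i} {glue B B′ S T} {B′ i}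
    (count (λ x → T x ∧ lookup (newPattern B B′ x) i))
    (trans (∣B′∣≡∣B∣+new B B′ restrict i) (cong (∣ B i ∣ +_) (halves i)))
    (∣glue∩B′∣≡∣S∩B∣+marked B B′ restrict i S T)
    (S-splits i)
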